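{- Let $M$ be a monoid and let $\equiv$ be the equivalence relation on $\mathbf{P}(M)$ defined by $\mathfrak{p}\equiv\mathfrak{p}'$ iff $\mathfrak{p},\mathfrak{p}'$ have the same arity, $\mathrm{first}_1(\mathfrak{p})=\mathrm{first}_1(\mathfrak{p}')$ and $\mathrm{first}_1^{R}(\mathfrak{p})=\mathrm{first}_1^{R}(\mathfrak{p}')$. Then the map $\mathbb{P}_\equiv:=\downarrow_3\circ\downarrow_2\circ\downarrow_1$ is a $\mathbb{P}$-symbol for $\equiv$, and $\mathbb{P}_\equiv(\mathbf{P}(M))$ is the set of $M$-pigmented magnets. Moreover, the graded set $\mathbf{P}(M)/_{\equiv}$ (denoted $\mathsf{Magn}_{1,1}(M)$) is isomorphic to the graded set of $M$-pigmented magnets.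
   Context: Let $(M,\cdot,e)$ be a monoid. An $M$-pigmented letter is a pair written $i^\alpha$ with $i$ a positive integer (value) and $\alpha\in M$ (pigment). $\mathbf{P}(M)(n)$ is the set of words of $M$-pigmented letters with values in $[n]$; $\mathbf{P}(M)=\bigsqcup_n\mathbf{P}(M)(n)$. For a word $\mathfrak{p}$, a position $j$ is a left $1$-witness if no letter of $\mathfrak{p}$ at a position $<j$ has the same value as $\mathfrak{p}(j)$, and a right $1$-witness if no letter at a position $>j$ has the same value as $\mathfrak{p}(j)$. $\mathrm{first}_1(\mathfrak{p})$ (resp. $\mathrm{first}_1^R(\mathfrak{p})$) is the subword of $\mathfrak{p}$ formed by the letters at left (resp. right) $1$-witness positions. Define binary relations on $\mathbf{P}(M)$ (with $\mathfrak{p},\mathfrak{p}'$ arbitrary words and statuses of positions computed in the left-hand word): (1) $\mathfrak{p}\,i^\alpha\,\mathfrak{p}'\leadsto_1\mathfrak{p}\,\mathfrak{p}'$ when the displayed position of $i^\alpha$ is neither a left nor a right $1$-witness; (2) $\mathfrak{p}\,i_1^{\alpha_1}i_2^{\alpha_2}\,\mathfrak{p}'\leadsto_2\mathfrak{p}\,i_2^{\alpha_2}i_1^{\alpha_1}\,\mathfrak{p}'$ when $i_1\ne i_2$, the position of $i_1^{\alpha_1}$ is not a right $1$-witness, and the position of $i_2^{\alpha_2}$ is not a left $1$-witness but is a right $1$-witness; (3) $\mathfrak{p}\,i^\alpha i^\alpha\,\mathfrak{p}'\leadsto_3\mathfrak{p}\,i^\alpha\,\mathfrak{p}'$. Let $\preccurlyeq_j$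 be the reflexive transitive closure of $\leadsto_j$ ($j\in[3]$); it is a partial order and for every $\mathfrak{p}$ there is exactly one maximal element $\mathfrak{q}$ of $(\mathbf{P}(M),\preccurlyeq_j)$ with $\mathfrak{p}\preccurlyeq_j\mathfrak{q}$; denote it $\downarrow_j(\mathfrak{p})$. An $M$-pigmented magnet of arity $n$ is an element of $\mathbf{P}(M)(n)$ that is maximal simultaneously for $\preccurlyeq_1,\preccurlyeq_2,\preccurlyeq_3$. A $\mathbb{P}$-symbol for an equivalence relation $\equiv$ on $\mathbf{P}(M)$ is a map $\mathbb{P}:\mathbf{P}(M)\to\mathbf{P}(M)$ such that $\mathfrak{p}\equiv\mathbb{P}(\mathfrak{p})$ for all $\mathfrak{p}$, and $\mathfrak{p}\equiv\mathfrak{p}'$ implies $\mathbb{P}(\mathfrak{p})=\mathbb{P}(\mathfrak{p}')$. -}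

module Defs where

open import Level using (Level)
open import Algebra.Bundles using (Monoid)
open import Data.Nat using (ℕ)
open import Data.Fin using (Fin; _≟_)
open import Data.Bool using (Bool; true; false; if_then_else_)
open import Data.List using (List; []; _∷_; _++_; reverse)
open import Data.List.Relation.Unary.Any using (Any)
open import Data.List.Relation.Unary.All using (All)
open import Data.Product using (Σ; _×_; _,_; proj₁; ∃)
open import Relation.Nullary using (¬_)
open import Relation.Nullary.Decidable using (⌊_⌋)
open import Relation.Binary.PropositionalEquality using (_≡_; _≢_)
open import Relation.Binary.Construct.Closure.ReflexiveTransitive using (Star)

module Pigmented {c ℓ : Level} (M : Monoid c ℓ) where

  -- Pigments are elements of the carrier of M, compared with (set-level) equality.
  Pigment : Set c
  Pigment = Monoid.Carrier M

  Letter : ℕ → Set c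
  Letter n = Fin n × Pigment

  val : ∀ {n} → Letter n → Fin n
  val = proj₁

  Word : ℕ → Set c
  Word n = List (Letter n)

  PM : Set c
  PM = Σ ℕ Word

  HasVal : ∀ {n} → Fin n → Word n → Set c
  HasVal i xs = Any (λ l → val l ≡ i) xs

  NoVal : ∀ {n} → Fin n → Word n → Set c
  NoVal i xs = All (λ l → val l ≢ i) xs

  -- Rewriting steps on words of arity n.
  -- Position of x in  p ++ x ∷ p'  is a left 1-witness iff NoVal (val x) p,
  -- and a right 1-witness iff NoVal (val x) p'.
  data Step₁ {n : ℕ} : Word n → Word n → Set c where
    del : (p p' : Word n) (x : Letter n) →
          HasVal (val x) p → HasVal (val x) p' →
          Step₁ (p ++ x ∷ p') (p ++ p')

  data Step₂ {n : ℕ} : Word n → Word n → Set c where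
    swap : (p p' : Word n) (x₁ x₂ : Letter n) →
           val x₁ ≢ val x₂ →
           HasVal (val x₁) (x₂ ∷ p') →          -- x₁ not a right 1-witness
           HasVal (val x₂) (p ++ x₁ ∷ []) →     -- x₂ not a left 1-witness
           NoVal (val x₂) p' →                  -- x₂ is a right 1-witness
           Step₂ (p ++ x₁ ∷ x₂ ∷ p') (p ++ x₂ ∷ x₁ ∷ p')

  data Step₃ {n : ℕ} : Word n → Word n → Set c where
    merge : (p p' : Word n) (x : Letter n) →
            Step₃ (p ++ x ∷ x ∷ p') (p ++ x ∷ p')

  data Lift (R : ∀ {n} → Word n → Word n → Set c) : PM → PM → Set c where
    lift : ∀ {n} {p q : Word n} → R p q → Lift R (n , p) (n , q)

  ↝₁ ↝₂ ↝₃ : PM → PM → Set c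
  ↝₁ = Lift Step₁
  ↝₂ = Lift Step₂
  ↝₃ = Lift Step₃

  _≼[_]_ : PM → (PM → PM → Set c) → PM → Set c
  p ≼[ R ] q = Star R p q

  Maximal : (PM → PM → Set c) → PM → Set c
  Maximal R q = ∀ r → q ≼[ R ] r → r ≡ q

  -- f is the map ↓ for R: f p is a maximal element above p
  -- (by the context such an element exists and is unique, so f = ↓).
  IsDown : (PM → PM → Set c) → (PM → PM) → Set c
  IsDown R f = ∀ p → (p ≼[ R ] f p) × Maximal R (f p)

  IsMagnet : PM → Set c
  IsMagnet q = Maximal ↝₁ q × Maximal ↝₂ q × Maximal ↝₃ q

  elem : ∀ {n} → Fin n → List (Fin n) → Bool
  elem i [] = false
  elem i (j ∷ js) = if ⌊ i ≟ j ⌋ then true else elem i js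

  firstFrom : ∀ {n} → List (Fin n) → Word n → Word n
  firstFrom seen [] = []
  firstFrom seen (x ∷ xs) =
    if elem (val x) seen then firstFrom seen xs
    else x ∷ firstFrom (val x ∷ seen) xs

  first₁ : ∀ {n} → Word n → Word n
  first₁ = firstFrom []

  first₁ᴿ : ∀ {n} → Word n → Word n
  first₁ᴿ p = reverse (first₁ (reverse p))

  data _≡M_ : PM → PM → Set c where
    eqv : ∀ {n} {p p' : Word n} →
          first₁ p ≡ first₁ p' → first₁ᴿ p ≡ first₁ᴿ p' →
          (n , p) ≡M (n , p')

  IsPSymbol : (PM → PM → Set c) → (PM → PM) → Set c
  IsPSymbol E P = (∀ p → E p (P p)) × (∀ p p' → E p p' → P p ≡ P p')

  Magnet : ℕ → Set c
  Magnet n = Σ (Word n) (λ p → IsMagnet (n , p))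

  -- Bijection between P(M)(n)/≡ and the magnets of arity n
  -- (magnets compared by their underlying word).
  QuotIso : ℕ → Set c
  QuotIso n =
    Σ (Word n → Magnet n) λ f →
      (∀ p p' → (n , p) ≡M (n , p') → proj₁ (f p) ≡ proj₁ (f p')) ×
      (∀ p p' → proj₁ (f p) ≡ proj₁ (f p') → (n , p) ≡M (n , p')) ×
      (∀ (m : Magnet n) → ∃ λ p → proj₁ (f p) ≡ proj₁ m)

{-# OPTIONS --safe #-}
-- Every rewriting step preserves first₁ and first₁ᴿ, where first₁ᴿ is read as the subword of
-- last occurrences; hence ℙ 𝔭 ≡ 𝔭. After ↓₁ every value occurs at most twice; ↝₂ permutes
-- letters and ↝₃ deletes one, so no third occurrence ever appears, and on such words ↝₃ cannot
-- create a ↝₂-redex: ℙ 𝔭 is a magnet. Finally, a magnet is determined by first₁ and first₁ᴿ: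
-- reading it from the left, a letter whose value was already seen must be the next last
-- occurrence and any other letter the next first occurrence, the magnet conditions excluding
-- every alternative. So ℙ is constant on classes and fixes magnets.
module Submission where

open import Defs
open import Level using (Level)
open import Algebra.Bundles using (Monoid)
open import Data.Nat using (ℕ; suc; _+_; _≤_; z≤n; s≤s; s≤s⁻¹)
open import Data.Nat.Properties
  using (≤-trans; ≤-refl; n≤1+n; +-mono-≤; +-monoʳ-≤; ≰⇒>; _≤?_; +-commutativeSemigroup)
  renaming (≡-irrelevant to ℕ-≡-irrelevant)
open import Algebra.Properties.CommutativeSemigroup +-commutativeSemigroup using (x∙yz≈y∙xz)
open import Data.Fin using (Fin; _≟_)
open import Data.Bool using (true; false; if_then_else_)
open import Data.Bool.Properties using (¬-not)
open import Data.List using (List; []; _∷_; _++_; _∷ʳ_; [_]; reverse)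
open import Data.List.Properties
  using (++-assoc; ++-cancelˡ; ∷ʳ-++; unfold-reverse; reverse-++; ∷-injectiveˡ; ∷-injectiveʳ)
open import Data.List.Relation.Unary.Any using (Any; here; there; any?; tail)
open import Data.List.Relation.Unary.All using (All; []; _∷_)
import Data.List.Relation.Unary.Any.Properties as Any
import Data.List.Relation.Unary.All.Properties as All
open import Data.List.Relation.Unary.All.Properties.Core using (¬Any⇒All¬; All¬⇒¬Any)
open import Data.Product using (_×_; _,_; proj₁; proj₂; ∃)
open import Data.Product.Properties using (,-injectiveʳ-UIP)
open import Data.Sum using (_⊎_; inj₁; inj₂; [_,_]′; map₂)
open import Data.Empty using (⊥; ⊥-elim)
open import Function using (id; _∘_; _∋_; _⇔_; mk⇔; Equivalence)
open import Relation.Nullary using (¬_; yes; no; Dec)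
open import Relation.Unary using (Pred)
open import Relation.Binary.PropositionalEquality using (_≡_; _≢_; refl; sym; trans; cong; cong₂; subst; module ≡-Reasoning)
open import Relation.Binary.Construct.Closure.ReflexiveTransitive using (Star; ε; _◅_)

module _ {a p} {A : Set a} {P : Pred A p} where

  Any-duplicate : ∀ xs {x ys} → Any P (xs ++ x ∷ ys) → Any P (xs ++ x ∷ x ∷ ys)
  Any-duplicate xs h with Any.++⁻ xs h
  ... | inj₁ h′         = Any.++⁺ˡ h′
  ... | inj₂ (here px)  = Any.++⁺ʳ xs (here px)
  ... | inj₂ (there h′) = Any.++⁺ʳ xs (there (there h′))

  All-duplicate : ∀ xs {x ys} → All P (xs ++ x ∷ ys) → All P (xs ++ x ∷ x ∷ ys)
  All-duplicate xs h with All.++⁻ xs h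
  ... | h₁ , (px ∷ h₂) = All.++⁺ h₁ (px ∷ px ∷ h₂)

module _ {ℓ} {A : Set ℓ} where

  ∷≢ : ∀ {x : A} {xs : List A} → x ∷ xs ≢ xs
  ∷≢ {xs = y ∷ ys} e = ∷≢ (∷-injectiveʳ e)

  data PairOverlap (p : List A) (x : A) (p′ a : List A) (y z : A) (b : List A) : Set ℓ where
    before   : ∀ m → p ≡ a ++ y ∷ z ∷ m → b ≡ m ++ x ∷ p′ → PairOverlap p x p′ a y z b
    at-left  : a ≡ p → y ≡ x → z ∷ b ≡ p′ → PairOverlap p x p′ a y z b
    at-right : a ∷ʳ y ≡ p → z ≡ x → b ≡ p′ → PairOverlap p x p′ a y z b
    after    : ∀ m → a ≡ p ++ x ∷ m → p′ ≡ m ++ y ∷ z ∷ b → PairOverlap p x p′ a y z b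

  pairOverlap : ∀ p {x p′} a {y z b} → p ++ x ∷ p′ ≡ a ++ y ∷ z ∷ b → PairOverlap p x p′ a y z b
  pairOverlap []               []      refl = at-left refl refl refl
  pairOverlap []               (_ ∷ a) refl = after a refl refl
  pairOverlap (_ ∷ [])         []      refl = at-right refl refl refl
  pairOverlap (_ ∷ _ ∷ p)      []      refl = before p refl refl
  pairOverlap (q ∷ p)          (_ ∷ a) eq with refl ← ∷-injectiveˡ eq with pairOverlap p a (∷-injectiveʳ eq)
  ... | before m e₁ e₂   = before m (cong (q ∷_) e₁) e₂
  ... | at-left e₁ e₂ e₃  = at-left (cong (q ∷_) e₁) e₂ e₃
  ... | at-right e₁ e₂ e₃ = at-right (cong (q ∷_) e₁) e₂ e₃
  ... | after m e₁ e₂    = after m (cong (q ∷_) e₁) e₂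

module Magnets {c ℓ : Level} (M : Monoid c ℓ) where
  open Pigmented M

  private
    variable
      n : ℕ
      i : Fin n
      x : Letter n
      p q w w′ : Word n

  hasVal? : (i : Fin n) (xs : Word n) → Dec (HasVal i xs)
  hasVal? i = any? (λ l → val l ≟ i)

  elem-here : ∀ (i : Fin n) S → elem i (i ∷ S) ≡ true
  elem-here i S with i ≟ i
  ... | yes _  = refl
  ... | no i≢i = ⊥-elim (i≢i refl)

  elem-there : ∀ (i j : Fin n) S → elem i S ≡ true → elem i (j ∷ S) ≡ true
  elem-there i j S e with i ≟ j
  ... | yes _ = refl
  ... | no _  = e

  elem-∷⁻ : ∀ (i j : Fin n) S → elem i (j ∷ S) ≡ true → i ≡ j ⊎ elem i S ≡ true
  elem-∷⁻ i j S e with i ≟ j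
  ... | yes i≡j = inj₁ i≡j
  ... | no _    = inj₂ e

  firstFrom-seen : ∀ S x (p : Word n) → elem (val x) S ≡ true → firstFrom S (x ∷ p) ≡ firstFrom S p
  firstFrom-seen S x p e rewrite e = refl

  firstFrom-unseen : ∀ S x (p : Word n) → elem (val x) S ≡ false → firstFrom S (x ∷ p) ≡ x ∷ firstFrom (val x ∷ S) p
  firstFrom-unseen S x p e rewrite e = refl

  seenAfter : List (Fin n) → Word n → List (Fin n)
  seenAfter S []       = S
  seenAfter S (x ∷ xs) = if elem (val x) S then seenAfter S xs else seenAfter (val x ∷ S) xs

  firstFrom-++ : ∀ S (p q : Word n) → firstFrom S (p ++ q) ≡ firstFrom S p ++ firstFrom (seenAfter S p) q
  firstFrom-++ S []      q = refl
  firstFrom-++ S (x ∷ p) q with elem (val x) S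
  ... | true  = firstFrom-++ S p q
  ... | false = cong (x ∷_) (firstFrom-++ (val x ∷ S) p q)

  seenAfter⁺ : ∀ S (p : Word n) → elem i S ≡ true ⊎ HasVal i p → elem i (seenAfter S p) ≡ true
  seenAfter⁺ S [] (inj₁ e) = e
  seenAfter⁺ {i = i} S (x ∷ p) h with elem (val x) S in e | h
  ... | true  | inj₁ e′          = seenAfter⁺ S p (inj₁ e′)
  ... | true  | inj₂ (here refl) = seenAfter⁺ S p (inj₁ e)
  ... | true  | inj₂ (there h′)  = seenAfter⁺ S p (inj₂ h′)
  ... | false | inj₁ e′          = seenAfter⁺ (val x ∷ S) p (inj₁ (elem-there i (val x) S e′))
  ... | false | inj₂ (here refl) = seenAfter⁺ (val x ∷ S) p (inj₁ (elem-here (val x) S))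
  ... | false | inj₂ (there h′)  = seenAfter⁺ (val x ∷ S) p (inj₂ h′)

  seenAfter⁻ : ∀ S (p : Word n) → elem i (seenAfter S p) ≡ true → elem i S ≡ true ⊎ HasVal i p
  seenAfter⁻ S [] e = inj₁ e
  seenAfter⁻ {i = i} S (x ∷ p) e with elem (val x) S
  ... | true = map₂ there (seenAfter⁻ S p e)
  ... | false with seenAfter⁻ (val x ∷ S) p e
  ...   | inj₂ h = inj₂ (there h)
  ...   | inj₁ e′ with elem-∷⁻ i (val x) S e′
  ...     | inj₁ refl = inj₂ (here refl)
  ...     | inj₂ e″   = inj₁ e″

  lastOcc : Word n → Word n
  lastOcc []       = []
  lastOcc (x ∷ xs) with hasVal? (val x) xs
  ... | yes _ = lastOcc xs
  ... | no _  = x ∷ lastOcc xs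

  lastOcc-repeated : HasVal (val x) p → lastOcc (x ∷ p) ≡ lastOcc p
  lastOcc-repeated {x = x} {p = p} h with hasVal? (val x) p
  ... | yes _ = refl
  ... | no ¬h = ⊥-elim (¬h h)

  lastOcc-last : ¬ HasVal (val x) p → lastOcc (x ∷ p) ≡ x ∷ lastOcc p
  lastOcc-last {x = x} {p = p} ¬h with hasVal? (val x) p
  ... | yes h = ⊥-elim (¬h h)
  ... | no _  = refl

  lastOcc-∷-nonempty : ∀ x (p : Word n) → lastOcc (x ∷ p) ≢ []
  lastOcc-∷-nonempty x p e with hasVal? (val x) p
  lastOcc-∷-nonempty x (y ∷ p) e | yes _ = lastOcc-∷-nonempty y p e

  first₁ᴿ-∷ : ∀ x (p : Word n) → first₁ᴿ (x ∷ p) ≡ firstFrom (seenAfter [] (reverse p)) [ x ] ++ first₁ᴿ p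
  first₁ᴿ-∷ x p = begin
    reverse (first₁ (reverse (x ∷ p)))      ≡⟨ cong (reverse ∘ first₁) (unfold-reverse x p) ⟩
    reverse (first₁ (reverse p ∷ʳ x))        ≡⟨ cong reverse (firstFrom-++ [] (reverse p) [ x ]) ⟩
    reverse (first₁ (reverse p) ++ lastPart) ≡⟨ reverse-++ (first₁ (reverse p)) lastPart ⟩
    reverse lastPart ++ first₁ᴿ p            ≡⟨ cong (_++ first₁ᴿ p) reverse-lastPart ⟩
    lastPart ++ first₁ᴿ p                    ∎
    where
      open ≡-Reasoning
      lastPart : Word _
      lastPart = firstFrom (seenAfter [] (reverse p)) [ x ]
      reverse-lastPart : reverse lastPart ≡ lastPart
      reverse-lastPart with elem (val x) (seenAfter [] (reverse p))
      ... | true  = refl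
      ... | false = refl

  first₁ᴿ≡lastOcc : ∀ (p : Word n) → first₁ᴿ p ≡ lastOcc p
  first₁ᴿ≡lastOcc []      = refl
  first₁ᴿ≡lastOcc (x ∷ p) = begin
    first₁ᴿ (x ∷ p)                    ≡⟨ first₁ᴿ-∷ x p ⟩
    firstFrom seen [ x ] ++ first₁ᴿ p  ≡⟨ cong (firstFrom seen [ x ] ++_) (first₁ᴿ≡lastOcc p) ⟩
    firstFrom seen [ x ] ++ lastOcc p  ≡⟨ head-part ⟩
    lastOcc (x ∷ p)                    ∎
    where
      open ≡-Reasoning
      seen : List (Fin _)
      seen = seenAfter [] (reverse p)
      head-part : firstFrom seen [ x ] ++ lastOcc p ≡ lastOcc (x ∷ p)
      head-part with hasVal? (val x) p
      ... | yes h = cong (_++ lastOcc p) (firstFrom-seen seen x [] (seenAfter⁺ [] (reverse p) (inj₂ (Any.reverse⁺ h))))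
      ... | no ¬h = cong (_++ lastOcc p) (firstFrom-unseen seen x [] (¬-not unseen))
        where
          unseen : elem (val x) seen ≢ true
          unseen e = [ (λ ()) , ¬h ∘ Any.reverse⁻ ]′ (seenAfter⁻ [] (reverse p) e)

  firstFrom-drop₂ : ∀ T (x y : Letter n) q → elem (val y) (val x ∷ T) ≡ true →
                    firstFrom T (x ∷ y ∷ q) ≡ firstFrom T (x ∷ q)
  firstFrom-drop₂ T x y q seen with elem (val x) T in e
  ... | false = cong (x ∷_) (firstFrom-seen (val x ∷ T) y q seen)
  ... | true with elem-∷⁻ (val y) (val x) T seen
  ...   | inj₁ y≡x   = firstFrom-seen T y q (trans (cong (λ k → elem k T) y≡x) e)
  ...   | inj₂ seen′ = firstFrom-seen T y q seen′

  first₁-cong-suffix : ∀ (p : Word n) {q q′} → firstFrom (seenAfter [] p) q ≡ firstFrom (seenAfter [] p) q′ →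
                       first₁ (p ++ q) ≡ first₁ (p ++ q′)
  first₁-cong-suffix p {q} {q′} e =
    trans (firstFrom-++ [] p q) (trans (cong (first₁ p ++_) e) (sym (firstFrom-++ [] p q′)))

  SameValues : Word n → Word n → Set c
  SameValues q q′ = ∀ i → HasVal i q ⇔ HasVal i q′

  SameValues-++ : ∀ (p : Word n) {q q′} → SameValues q q′ → SameValues (p ++ q) (p ++ q′)
  SameValues-++ p sv i = mk⇔ (transfer (Equivalence.to (sv i))) (transfer (Equivalence.from (sv i)))
    where
      transfer : ∀ {q q′} → (HasVal i q → HasVal i q′) → HasVal i (p ++ q) → HasVal i (p ++ q′)
      transfer f h = [ Any.++⁺ˡ , Any.++⁺ʳ p ∘ f ]′ (Any.++⁻ p h)

  SameValues-repeated : HasVal (val x) q → SameValues (x ∷ q) q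
  SameValues-repeated h i = mk⇔ (λ { (here refl) → h ; (there h′) → h′ }) there

  SameValues-swap : ∀ (x y : Letter n) q → SameValues (x ∷ y ∷ q) (y ∷ x ∷ q)
  SameValues-swap x y q i = mk⇔ swapped swapped
    where
      swapped : ∀ {a b : Letter _} → HasVal i (a ∷ b ∷ q) → HasVal i (b ∷ a ∷ q)
      swapped (here e)         = there (here e)
      swapped (there (here e)) = here e
      swapped (there (there h)) = there (there h)

  lastOcc-cong-suffix : ∀ (p : Word n) {q q′} → SameValues q q′ → lastOcc q ≡ lastOcc q′ →
                        lastOcc (p ++ q) ≡ lastOcc (p ++ q′)
  lastOcc-cong-suffix []      sv e = e
  lastOcc-cong-suffix (x ∷ p) {q} {q′} sv e with hasVal? (val x) (p ++ q) | hasVal? (val x) (p ++ q′)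
  ... | yes _ | yes _  = lastOcc-cong-suffix p sv e
  ... | no _  | no _   = cong (x ∷_) (lastOcc-cong-suffix p sv e)
  ... | yes h | no ¬h′ = ⊥-elim (¬h′ (Equivalence.to (SameValues-++ p sv (val x)) h))
  ... | no ¬h | yes h′ = ⊥-elim (¬h (Equivalence.from (SameValues-++ p sv (val x)) h′))

  ≡M-intro : first₁ w ≡ first₁ w′ → lastOcc w ≡ lastOcc w′ → (n , w) ≡M (n , w′)
  ≡M-intro {w = w} {w′ = w′} e₁ e₂ =
    eqv e₁ (trans (first₁ᴿ≡lastOcc w) (trans e₂ (sym (first₁ᴿ≡lastOcc w′))))

  step₁-≡M : Step₁ w w′ → (n , w) ≡M (n , w′)
  step₁-≡M (del p p′ x hp hp′) =
    ≡M-intro (first₁-cong-suffix p (firstFrom-seen (seenAfter [] p) x p′ (seenAfter⁺ [] p (inj₂ hp))))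
             (lastOcc-cong-suffix p (SameValues-repeated hp′) (lastOcc-repeated hp′))

  step₂-≡M : Step₂ w w′ → (n , w) ≡M (n , w′)
  step₂-≡M (swap p p′ x₁ x₂ x₁≢x₂ h₁ h₂ last₂) =
    ≡M-intro (first₁-cong-suffix p (trans (firstFrom-drop₂ T x₁ x₂ p′ (elem-there (val x₂) (val x₁) T seen₂))
                                          (sym (firstFrom-seen T x₂ (x₁ ∷ p′) seen₂))))
             (lastOcc-cong-suffix p (SameValues-swap x₁ x₂ p′) lastOcc-swap)
    where
      T : List (Fin _)
      T = seenAfter [] p
      seen₂ : elem (val x₂) T ≡ true
      seen₂ = seenAfter⁺ [] p (inj₂ ([ id , (λ { (here e) → ⊥-elim (x₁≢x₂ e) }) ]′ (Any.++⁻ p h₂)))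
      lastOcc-swap : lastOcc (x₁ ∷ x₂ ∷ p′) ≡ lastOcc (x₂ ∷ x₁ ∷ p′)
      lastOcc-swap = begin
        lastOcc (x₁ ∷ x₂ ∷ p′) ≡⟨ lastOcc-repeated h₁ ⟩
        lastOcc (x₂ ∷ p′)      ≡⟨ lastOcc-last (All¬⇒¬Any last₂) ⟩
        x₂ ∷ lastOcc p′        ≡⟨ cong (x₂ ∷_) (lastOcc-repeated (tail (x₁≢x₂ ∘ sym) h₁)) ⟨
        x₂ ∷ lastOcc (x₁ ∷ p′) ≡⟨ lastOcc-last (All¬⇒¬Any (x₁≢x₂ ∷ last₂)) ⟨
        lastOcc (x₂ ∷ x₁ ∷ p′) ∎
        where open ≡-Reasoning

  step₃-≡M : Step₃ w w′ → (n , w) ≡M (n , w′)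
  step₃-≡M (merge p p′ x) =
    ≡M-intro (first₁-cong-suffix p (firstFrom-drop₂ (seenAfter [] p) x x p′ (elem-here (val x) (seenAfter [] p))))
             (lastOcc-cong-suffix p (SameValues-repeated x-again) (lastOcc-repeated x-again))
    where
      x-again : HasVal (val x) (x ∷ p′)
      x-again = here refl

  NoStep : (∀ {n} → Word n → Word n → Set c) → Word n → Set c
  NoStep R w = ∀ {w′} → ¬ R w w′

  count : Fin n → Word n → ℕ
  count i []       = 0
  count i (x ∷ xs) with val x ≟ i
  ... | yes _ = suc (count i xs)
  ... | no _  = count i xs

  count-++ : ∀ i (p q : Word n) → count i (p ++ q) ≡ count i p + count i q
  count-++ i []      q = refl
  count-++ i (x ∷ p) q with val x ≟ i
  ... | yes _ = cong suc (count-++ i p q)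
  ... | no _  = count-++ i p q

  count-head : ∀ (x : Letter n) q → count (val x) (x ∷ q) ≡ suc (count (val x) q)
  count-head x q with val x ≟ val x
  ... | yes _  = refl
  ... | no x≢x = ⊥-elim (x≢x refl)

  count-∷-≤ : ∀ i (x : Letter n) q → count i q ≤ count i (x ∷ q)
  count-∷-≤ i x q with val x ≟ i
  ... | yes _ = n≤1+n (count i q)
  ... | no _  = ≤-refl

  count-swap : ∀ i (x y : Letter n) q → count i (x ∷ y ∷ q) ≡ count i (y ∷ x ∷ q)
  count-swap i x y q = begin
    count i (x ∷ y ∷ q)                           ≡⟨ count-++ i [ x ] (y ∷ q) ⟩
    count i [ x ] + count i (y ∷ q)               ≡⟨ cong (count i [ x ] +_) (count-++ i [ y ] q) ⟩
    count i [ x ] + (count i [ y ] + count i q)   ≡⟨ x∙yz≈y∙xz (count i [ x ]) (count i [ y ]) (count i q) ⟩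
    count i [ y ] + (count i [ x ] + count i q)   ≡⟨ cong (count i [ y ] +_) (count-++ i [ x ] q) ⟨
    count i [ y ] + count i (x ∷ q)               ≡⟨ count-++ i [ y ] (x ∷ q) ⟨
    count i (y ∷ x ∷ q)                           ∎
    where open ≡-Reasoning

  count-pos : HasVal i q → 1 ≤ count i q
  count-pos {i = i} {q = x ∷ q} (here refl) rewrite count-head x q = s≤s z≤n
  count-pos {i = i} {q = x ∷ q} (there h)   = ≤-trans (count-pos h) (count-∷-≤ i x q)

  count-split : ∀ {k} i (w : Word n) → suc k ≤ count i w →
                ∃ λ a → ∃ λ y → ∃ λ b → w ≡ a ++ y ∷ b × val y ≡ i × k ≤ count i b
  count-split i (x ∷ w) k<count with val x ≟ i
  ... | yes x≡i = [] , x , w , refl , x≡i , s≤s⁻¹ k<count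
  ... | no _ with count-split i w k<count
  ...   | a , y , b , refl , y≡i , k≤b = x ∷ a , y , b , refl , y≡i , k≤b

  AtMostTwice : Word n → Set
  AtMostTwice {n} w = (i : Fin n) → count i w ≤ 2

  atMostTwice⇒noStep₁ : AtMostTwice w → NoStep Step₁ w
  atMostTwice⇒noStep₁ ≤2 (del p p′ x hp hp′) = three≰two (≤-trans three≤count (≤2 (val x)))
    where
      three≰two : ¬ 3 ≤ 2
      three≰two (s≤s (s≤s ()))
      three≤count : 3 ≤ count (val x) (p ++ x ∷ p′)
      three≤count rewrite count-++ (val x) p (x ∷ p′) | count-head x p′ =
        +-mono-≤ (count-pos hp) (s≤s (count-pos hp′))

  noStep₁⇒atMostTwice : NoStep Step₁ w → AtMostTwice w
  noStep₁⇒atMostTwice {w = w} ns i with count i w ≤? 2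
  ... | yes ≤2 = ≤2
  ... | no ≰2 with count-split i w (≰⇒> ≰2)
  ... | a , y , b , refl , refl , 2≤b with count-split (val y) b 2≤b
  ... | a′ , z , b′ , refl , z≡y , 1≤b′ with count-split (val y) b′ 1≤b′
  ... | a″ , z′ , b″ , refl , z′≡y , _ = ⊥-elim (
    subst (NoStep Step₁) (sym (++-assoc a (y ∷ a′) (z ∷ b′))) ns
              (del (a ++ y ∷ a′) b′ z (Any.++⁺ʳ a (here (sym z≡y)))
                                      (Any.++⁺ʳ a″ (here (trans z′≡y (sym z≡y))))))

  step₂-preserves-noStep₁ : Step₂ w w′ → NoStep Step₁ w → NoStep Step₁ w′
  step₂-preserves-noStep₁ (swap p p′ x₁ x₂ _ _ _ _) ns =
    atMostTwice⇒noStep₁ λ i → subst (_≤ 2) (same-count i) (noStep₁⇒atMostTwice ns i)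
    where
      same-count : ∀ i → count i (p ++ x₁ ∷ x₂ ∷ p′) ≡ count i (p ++ x₂ ∷ x₁ ∷ p′)
      same-count i = begin
        count i (p ++ x₁ ∷ x₂ ∷ p′)          ≡⟨ count-++ i p (x₁ ∷ x₂ ∷ p′) ⟩
        count i p + count i (x₁ ∷ x₂ ∷ p′)   ≡⟨ cong (count i p +_) (count-swap i x₁ x₂ p′) ⟩
        count i p + count i (x₂ ∷ x₁ ∷ p′)   ≡⟨ count-++ i p (x₂ ∷ x₁ ∷ p′) ⟨
        count i (p ++ x₂ ∷ x₁ ∷ p′)          ∎
        where open ≡-Reasoning

  step₃-preserves-noStep₁ : Step₃ w w′ → NoStep Step₁ w → NoStep Step₁ w′
  step₃-preserves-noStep₁ (merge p p′ x) ns =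
    atMostTwice⇒noStep₁ λ i → ≤-trans (fewer i) (noStep₁⇒atMostTwice ns i)
    where
      fewer : ∀ i → count i (p ++ x ∷ p′) ≤ count i (p ++ x ∷ x ∷ p′)
      fewer i rewrite count-++ i p (x ∷ p′) | count-++ i p (x ∷ x ∷ p′) =
        +-monoʳ-≤ (count i p) (count-∷-≤ i x (x ∷ p′))

  -- A ↝₂-redex meeting the merged letter would give its value three occurrences.
  step₃-preserves-noStep₂ : Step₃ w w′ → NoStep Step₁ w → NoStep Step₂ w → NoStep Step₂ w′
  step₃-preserves-noStep₂ (merge p p′ x) ns₁ ns₂ s = noSwap s refl
    where
      noSwap : ∀ {v v′} → Step₂ v v′ → v ≡ p ++ x ∷ p′ → ⊥
      noSwap (swap a b y z y≢z hy hz last-z) eq with pairOverlap p a (sym eq)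
      ... | before m refl refl =
        subst (NoStep Step₂) (++-assoc a (y ∷ z ∷ m) (x ∷ x ∷ p′)) ns₂
                   (swap a (m ++ x ∷ x ∷ p′) y z y≢z (Any-duplicate (z ∷ m) hy) hz (All-duplicate m last-z))
      ... | at-left refl refl refl =
        subst (NoStep Step₁) (sym (∷ʳ-++ p x (x ∷ p′))) ns₁ (del (p ∷ʳ x) p′ x (Any.++⁺ʳ p (here refl)) hy)
      ... | at-right refl refl refl = ns₁ (del p (x ∷ p′) x hz (here refl))
      ... | after m refl refl =
        subst (NoStep Step₂) (sym (++-assoc p (x ∷ x ∷ m) (y ∷ z ∷ b))) ns₂
              (swap (p ++ x ∷ x ∷ m) b y z y≢z hy z-seen last-z)
        where
          z-seen : HasVal (val z) ((p ++ x ∷ x ∷ m) ∷ʳ y)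
          z-seen = subst (HasVal (val z)) (sym (++-assoc p (x ∷ x ∷ m) [ y ]))
                     (Any-duplicate p (subst (HasVal (val z)) (++-assoc p (x ∷ m) [ y ]) hz))

  ,-injectiveʳ-word : {w w′ : Word n} → (PM ∋ (n , w)) ≡ (n , w′) → w ≡ w′
  ,-injectiveʳ-word = ,-injectiveʳ-UIP ℕ-≡-irrelevant

  OnWord : (∀ {n} → Word n → Set c) → PM → Set c
  OnWord P a = P (proj₂ a)

  maximal⇒noStep : {R : ∀ {n} → Word n → Word n → Set c} → (∀ {n} {w w′ : Word n} → R w w′ → w ≢ w′) →
                   ∀ {b} → Maximal (Lift R) b → OnWord (NoStep R) b
  maximal⇒noStep irreflexive max r = irreflexive r (sym (,-injectiveʳ-word (max _ (lift r ◅ ε))))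

  noStep⇒maximal : {R : ∀ {n} → Word n → Word n → Set c} → ∀ {b} → OnWord (NoStep R) b → Maximal (Lift R) b
  noStep⇒maximal ns _ ε              = refl
  noStep⇒maximal ns _ (lift r ◅ _) = ⊥-elim (ns r)

  step₁-irreflexive : Step₁ w w′ → w ≢ w′
  step₁-irreflexive (del p p′ x _ _) e = ∷≢ (++-cancelˡ p (x ∷ p′) p′ e)

  step₂-irreflexive : Step₂ w w′ → w ≢ w′
  step₂-irreflexive (swap p p′ x₁ x₂ x₁≢x₂ _ _ _) e = x₁≢x₂ (cong val (∷-injectiveˡ (++-cancelˡ p _ _ e)))

  step₃-irreflexive : Step₃ w w′ → w ≢ w′
  step₃-irreflexive (merge p p′ x) e = ∷≢ (∷-injectiveʳ (++-cancelˡ p (x ∷ x ∷ p′) (x ∷ p′) e))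

  Magnetic : Word n → Set c
  Magnetic w = NoStep Step₁ w × NoStep Step₂ w × NoStep Step₃ w

  isMagnet⇒magnetic : ∀ {b} → IsMagnet b → OnWord Magnetic b
  isMagnet⇒magnetic (max₁ , max₂ , max₃) =
    maximal⇒noStep step₁-irreflexive max₁ , maximal⇒noStep step₂-irreflexive max₂ , maximal⇒noStep step₃-irreflexive max₃

  magnetic-shift : ∀ (u : Word n) x t → Magnetic (u ++ x ∷ t) → Magnetic ((u ∷ʳ x) ++ t)
  magnetic-shift u x t = subst Magnetic (sym (∷ʳ-++ u x t))

  -- Otherwise the letter just before z, which is not a last occurrence, would form a redex with z.
  lastOcc-head-fresh : ∀ (u : Word n) x t {z rest} → Magnetic (u ++ x ∷ t) → HasVal (val x) t →
                       x ≡ z ⊎ HasVal (val z) u → lastOcc t ≢ z ∷ rest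
  lastOcc-head-fresh u x (y ∷ t) {z} mg hx earlier e with hasVal? (val y) t
  ... | yes hy = lastOcc-head-fresh (u ∷ʳ x) y t (magnetic-shift u x (y ∷ t) mg) hy (inj₂ (earlier′ earlier)) e
    where
      earlier′ : x ≡ z ⊎ HasVal (val z) u → HasVal (val z) (u ∷ʳ x)
      earlier′ (inj₁ refl) = Any.++⁺ʳ u (here refl)
      earlier′ (inj₂ h)    = Any.++⁺ˡ h
  lastOcc-head-fresh u x (y ∷ t) (ns₁ , ns₂ , ns₃) hx earlier refl | no ¬hy with val x ≟ val y | earlier
  ... | no x≢y  | inj₁ refl = x≢y refl
  ... | no x≢y  | inj₂ h    = ns₂ (swap u t x y x≢y hx (Any.++⁺ˡ h) (¬Any⇒All¬ t ¬hy))
  ... | yes _   | inj₁ refl = ns₃ (merge u t x)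
  ... | yes x≈y | inj₂ h    = ns₁ (del u (y ∷ t) x (subst (λ k → HasVal k u) (sym x≈y) h) (here (sym x≈y)))

  SeenIn : List (Fin n) → Word n → Set c
  SeenIn {n} S u = (i : Fin n) → elem i S ≡ true → HasVal i u

  SeenIn-∷ʳ : ∀ S (u : Word n) x → SeenIn S u → SeenIn S (u ∷ʳ x)
  SeenIn-∷ʳ S u x seen i = Any.++⁺ˡ ∘ seen i

  SeenIn-∷ʳ-new : ∀ S (u : Word n) x → SeenIn S u → SeenIn (val x ∷ S) (u ∷ʳ x)
  SeenIn-∷ʳ-new S u x seen i e with elem-∷⁻ i (val x) S e
  ... | inj₁ refl = Any.++⁺ʳ u (here refl)
  ... | inj₂ e′   = Any.++⁺ˡ (seen i e′)

  seen⇒lastOcc-last : ∀ S (u : Word n) x t → SeenIn S u → Magnetic (u ++ x ∷ t) →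
                      elem (val x) S ≡ true → lastOcc (x ∷ t) ≡ x ∷ lastOcc t
  seen⇒lastOcc-last S u x t seen (ns₁ , _) e = lastOcc-last (ns₁ ∘ del u t x (seen (val x) e))

  seen-unseen-lastOcc : ∀ S (u : Word n) x t x′ t′ → SeenIn S u → Magnetic (u ++ x ∷ t) → Magnetic (u ++ x′ ∷ t′) →
                        elem (val x) S ≡ true → elem (val x′) S ≡ false → lastOcc (x ∷ t) ≢ lastOcc (x′ ∷ t′)
  seen-unseen-lastOcc S u x t x′ t′ seen mg mg′ e e′ el =
    distinct (trans (sym (seen⇒lastOcc-last S u x t seen mg e)) el)
    where
      distinct : x ∷ lastOcc t ≢ lastOcc (x′ ∷ t′)
      distinct el′ with hasVal? (val x′) t′
      ... | yes h′ = lastOcc-head-fresh u x′ t′ mg′ h′ (inj₂ (seen (val x) e)) (sym el′)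
      ... | no _ with refl ← ∷-injectiveˡ el′ with () ← trans (sym e) e′

  -- S lists values of the common prefix u, so a head whose value is in S is a last occurrence.
  magnetic-suffix-unique : ∀ S (u : Word n) s s′ → SeenIn S u → Magnetic (u ++ s) → Magnetic (u ++ s′) →
                           firstFrom S s ≡ firstFrom S s′ → lastOcc s ≡ lastOcc s′ → s ≡ s′
  magnetic-suffix-unique S u []      []        _ _ _ _ _  = refl
  magnetic-suffix-unique S u []      (x′ ∷ t′) _ _ _ _ el = ⊥-elim (lastOcc-∷-nonempty x′ t′ (sym el))
  magnetic-suffix-unique S u (x ∷ t) []        _ _ _ _ el = ⊥-elim (lastOcc-∷-nonempty x t el)
  magnetic-suffix-unique S u (x ∷ t) (x′ ∷ t′) seen mg mg′ ef el
    with elem (val x) S in e | elem (val x′) S in e′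
  ... | true  | false = ⊥-elim (seen-unseen-lastOcc S u x t x′ t′ seen mg mg′ e e′ el)
  ... | false | true  = ⊥-elim (seen-unseen-lastOcc S u x′ t′ x t seen mg′ mg e′ e (sym el))
  ... | true  | true  = cong₂ _∷_ x≡x′ (magnetic-suffix-unique S (u ∷ʳ x) t t′ (SeenIn-∷ʳ S u x seen)
                          (magnetic-shift u x t mg) (subst (λ y → Magnetic ((u ∷ʳ y) ++ t′)) (sym x≡x′) (magnetic-shift u x′ t′ mg′))
                          ef (∷-injectiveʳ lastOcc-heads))
    where
      lastOcc-heads : x ∷ lastOcc t ≡ x′ ∷ lastOcc t′
      lastOcc-heads = trans (sym (seen⇒lastOcc-last S u x t seen mg e)) (trans el (seen⇒lastOcc-last S u x′ t′ seen mg′ e′))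
      x≡x′ : x ≡ x′
      x≡x′ = ∷-injectiveˡ lastOcc-heads
  ... | false | false with refl ← ∷-injectiveˡ ef =
    cong (x ∷_) (magnetic-suffix-unique (val x ∷ S) (u ∷ʳ x) t t′ (SeenIn-∷ʳ-new S u x seen)
                  (magnetic-shift u x t mg) (magnetic-shift u x t′ mg′) (∷-injectiveʳ ef)
                  (lastOcc-tails (hasVal? (val x) t) (hasVal? (val x) t′)))
    where
      lastOcc-tails : Dec (HasVal (val x) t) → Dec (HasVal (val x) t′) → lastOcc t ≡ lastOcc t′
      lastOcc-tails (yes h) (yes h′) = trans (sym (lastOcc-repeated h)) (trans el (lastOcc-repeated h′))
      lastOcc-tails (no ¬h) (no ¬h′) = ∷-injectiveʳ (trans (sym (lastOcc-last ¬h)) (trans el (lastOcc-last ¬h′)))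
      lastOcc-tails (yes h) (no ¬h′) = ⊥-elim (lastOcc-head-fresh u x t mg h (inj₁ refl)
                                         (trans (sym (lastOcc-repeated h)) (trans el (lastOcc-last ¬h′))))
      lastOcc-tails (no ¬h) (yes h′) = ⊥-elim (lastOcc-head-fresh u x t′ mg′ h′ (inj₁ refl)
                                         (trans (sym (lastOcc-repeated h′)) (trans (sym el) (lastOcc-last ¬h))))

  magnet-unique : ∀ {q q′} → IsMagnet q → IsMagnet q′ → q ≡M q′ → q ≡ q′
  magnet-unique mq mq′ (eqv {p = w} {p' = w′} e₁ e₂) =
    cong (_ ,_) (magnetic-suffix-unique [] [] w w′ (λ _ ()) (isMagnet⇒magnetic mq) (isMagnet⇒magnetic mq′) e₁
                  (trans (sym (first₁ᴿ≡lastOcc w)) (trans e₂ (first₁ᴿ≡lastOcc w′))))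

  ≡M-refl : ∀ a → a ≡M a
  ≡M-refl _ = eqv refl refl

  ≡M-sym : ∀ {a b} → a ≡M b → b ≡M a
  ≡M-sym (eqv e₁ e₂) = eqv (sym e₁) (sym e₂)

  ≡M-trans : ∀ {a b d} → a ≡M b → b ≡M d → a ≡M d
  ≡M-trans (eqv e₁ e₂) (eqv e₁′ e₂′) = eqv (trans e₁ e₁′) (trans e₂ e₂′)

  ≡M-arity : ∀ {b} → (n , w) ≡M b → ∃ λ w′ → b ≡ (n , w′)
  ≡M-arity (eqv {p' = w′} _ _) = w′ , refl

  star-≡M : {R : ∀ {n} → Word n → Word n → Set c} → (∀ {n} {w w′ : Word n} → R w w′ → (n , w) ≡M (n , w′)) →
            ∀ {a b} → Star (Lift R) a b → a ≡M b
  star-≡M step-≡M ε              = ≡M-refl _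
  star-≡M step-≡M (lift r ◅ rs) = ≡M-trans (step-≡M r) (star-≡M step-≡M rs)

  star-preserves : {R : ∀ {n} → Word n → Word n → Set c} (P : ∀ {n} → Word n → Set c) →
                   (∀ {n} {w w′ : Word n} → R w w′ → P w → P w′) →
                   ∀ {a b} → Star (Lift R) a b → OnWord P a → OnWord P b
  star-preserves P preserves ε              h = h
  star-preserves P preserves (lift r ◅ rs) h = star-preserves P preserves rs (preserves r h)

  down-fixes-maximal : ∀ {R d b} → IsDown R d → Maximal R b → d b ≡ b
  down-fixes-maximal {d = d} {b} down max = max (d b) (proj₁ (down b))

  module Normalisation (d₁ d₂ d₃ : PM → PM) (down₁ : IsDown ↝₁ d₁) (down₂ : IsDown ↝₂ d₂) (down₃ : IsDown ↝₃ d₃) where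

    ℙ : PM → PM
    ℙ = d₃ ∘ d₂ ∘ d₁

    ℙ-≡M : ∀ a → a ≡M ℙ a
    ℙ-≡M a = ≡M-trans (star-≡M step₁-≡M (proj₁ (down₁ a)))
               (≡M-trans (star-≡M step₂-≡M (proj₁ (down₂ (d₁ a))))
                         (star-≡M step₃-≡M (proj₁ (down₃ (d₂ (d₁ a))))))

    ℙ-magnet : ∀ a → IsMagnet (ℙ a)
    ℙ-magnet a = noStep⇒maximal (proj₁ after₃) , noStep⇒maximal (proj₂ after₃) , proj₂ (down₃ (d₂ (d₁ a)))
      where
        after₁ : OnWord (NoStep Step₁) (d₁ a)
        after₁ = maximal⇒noStep step₁-irreflexive (proj₂ (down₁ a))
        after₂ : OnWord (λ w → NoStep Step₁ w × NoStep Step₂ w) (d₂ (d₁ a))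
        after₂ = star-preserves (NoStep Step₁) step₂-preserves-noStep₁ (proj₁ (down₂ (d₁ a))) after₁
               , maximal⇒noStep step₂-irreflexive (proj₂ (down₂ (d₁ a)))
        after₃ : OnWord (λ w → NoStep Step₁ w × NoStep Step₂ w) (ℙ a)
        after₃ = star-preserves (λ w → NoStep Step₁ w × NoStep Step₂ w)
                   (λ r (ns₁ , ns₂) → step₃-preserves-noStep₁ r ns₁ , step₃-preserves-noStep₂ r ns₁ ns₂)
                   (proj₁ (down₃ (d₂ (d₁ a)))) after₂

    ℙ-fixes-magnets : ∀ b → IsMagnet b → ℙ b ≡ b
    ℙ-fixes-magnets b (max₁ , max₂ , max₃) = begin
      d₃ (d₂ (d₁ b)) ≡⟨ cong (d₃ ∘ d₂) (down-fixes-maximal down₁ max₁) ⟩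
      d₃ (d₂ b)      ≡⟨ cong d₃ (down-fixes-maximal down₂ max₂) ⟩
      d₃ b           ≡⟨ down-fixes-maximal down₃ max₃ ⟩
      b              ∎
      where open ≡-Reasoning

    ℙ-respects-≡M : ∀ a a′ → a ≡M a′ → ℙ a ≡ ℙ a′
    ℙ-respects-≡M a a′ a≡a′ =
      magnet-unique (ℙ-magnet a) (ℙ-magnet a′) (≡M-trans (≡M-sym (ℙ-≡M a)) (≡M-trans a≡a′ (ℙ-≡M a′)))

    ℙ-reflects-≡M : ∀ a a′ → ℙ a ≡ ℙ a′ → a ≡M a′
    ℙ-reflects-≡M a a′ e = ≡M-trans (subst (a ≡M_) e (ℙ-≡M a)) (≡M-sym (ℙ-≡M a′))

    normal : Word n → Word n
    normal {n} w = proj₁ (≡M-arity (ℙ-≡M (n , w)))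

    ℙ-normal : ∀ (w : Word n) → ℙ (n , w) ≡ (n , normal w)
    ℙ-normal {n} w = proj₂ (≡M-arity (ℙ-≡M (n , w)))

    quotIso : ∀ n → QuotIso n
    quotIso n = toMagnet , respects , reflects , onto
      where
        toMagnet : Word n → Magnet n
        toMagnet w = normal w , subst IsMagnet (ℙ-normal w) (ℙ-magnet (n , w))
        respects : ∀ p p′ → (n , p) ≡M (n , p′) → normal p ≡ normal p′
        respects p p′ e = ,-injectiveʳ-word (trans (sym (ℙ-normal p)) (trans (ℙ-respects-≡M _ _ e) (ℙ-normal p′)))
        reflects : ∀ p p′ → normal p ≡ normal p′ → (n , p) ≡M (n , p′)
        reflects p p′ e = ℙ-reflects-≡M _ _ (trans (ℙ-normal p) (trans (cong (n ,_) e) (sym (ℙ-normal p′))))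
        onto : ∀ (m : Magnet n) → ∃ λ w → normal w ≡ proj₁ m
        onto (w , magnet) = w , ,-injectiveʳ-word (trans (sym (ℙ-normal w)) (ℙ-fixes-magnets (n , w) magnet))

theorem5p1p8 : ∀ {c ℓ : Level} (M : Monoid c ℓ) →
    let open Pigmented M in
    (d₁ d₂ d₃ : PM → PM) →
    IsDown ↝₁ d₁ → IsDown ↝₂ d₂ → IsDown ↝₃ d₃ →
    IsPSymbol _≡M_ (d₃ ∘ d₂ ∘ d₁) ×
    ((∀ p → IsMagnet ((d₃ ∘ d₂ ∘ d₁) p)) ×
     (∀ q → IsMagnet q → ∃ λ p → (d₃ ∘ d₂ ∘ d₁) p ≡ q)) ×
    (∀ n → QuotIso n)
theorem5p1p8 M d₁ d₂ d₃ down₁ down₂ down₃ =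
  (ℙ-≡M , ℙ-respects-≡M) , (ℙ-magnet , λ q magnet → q , ℙ-fixes-magnets q magnet) , quotIso
  where open Magnets.Normalisation M d₁ d₂ d₃ down₁ down₂ down₃
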